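{- Let $\alpha$ be a weak composition and let $i\in\{1,\ldots,\ell(\alpha)\}$ with $\alpha_i=0$. Let $\beta$ be a weak composition such that $\alpha\trianglelefteq\beta\trianglelefteq\operatorname{qshift}(\alpha)$. Define the composition $\gamma$ by $\gamma_i=\beta_i+\beta_{i+1}$, $\gamma_{i+1}=0$, and $\gamma_j=\beta_j$ for $j\notin\{i,i+1\}$. Then $\tilde{s}_i\alpha\trianglelefteq\gamma\trianglelefteq\operatorname{qshift}(\tilde{s}_i\alpha)$.
   Context: A weak composition is a finite sequence $\alpha=(\alpha_1,\ldots,\alpha_n)$ of nonnegative integers; $\ell(\alpha)=n$ is its length. Weak compositions are padded with trailing zeros whenever needed (e.g. $\alpha_{n+1}=0$), so that all vectors being compared have a common length. Dominance order: $\beta\trianglelefteq\gamma$ iff $\beta_1+\cdots+\beta_j\le\gamma_1+\cdots+\gamma_j$ for every $j$. Quasisymmetric action: $\tilde{s}_i(\alpha)$ is obtained from $\alpha$ by exchanging the entries in positions $i$ and $i+1$ if $\alpha_i=0$ or $\alpha_{i+1}=0$, and $\tilde{s}_i(\alpha)=\alpha$ otherwise. Fundamental shift: for $v=(v_1,\ldots,v_n)$ with nonnegative integer entries, let $S=\{i_1<\cdots<i_k\}$ be the set of positions of nonzero entries. Then $\operatorname{qshift}(v)=(w_1,\ldots,w_n)$ where: (1) for $j\in S$, $w_j=v_j$ if $j=1$ or $j-1\in S$, and $w_j=1$ otherwise; (2) if $i_j\in S$ with $j<k$ and $i_j+1\notin S$, then $w_{i_j+1}=v_{i_{j+1}}-1$;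 (3) if $1\notin S$ (and $S\neq\emptyset$), then $w_1=v_{i_1}-1$; (4) all other $w_j$ are $0$. Informally: working right to left, each positive entry $a$ with a zero immediately to its left is reduced to $1$ and the remaining $a-1$ is moved left to sit immediately right of the next nonzero entry (or into position 1 if there is none). Example: $\operatorname{qshift}(0,0,3,0,1,4,0,5)=(2,0,1,0,1,4,4,1)$. -}

module Defs where

open import Data.Nat using (ℕ; zero; suc; _+_; _∸_; _≤_; _⊔_; _≡ᵇ_)
open import Data.Bool using (Bool; true; false; if_then_else_; _∨_; not)
open import Data.List using (List; []; _∷_; length; take; drop; applyUpTo)
open import Data.Nat.ListAction using (sum)
open import Data.Maybe using (Maybe; just; nothing)

-- Weak compositions are lists of naturals; entries are 1-indexed and padded
-- with zeros: `at α j` is α_j (and 0 for j = 0 or j > ℓ(α)).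
WeakComp : Set
WeakComp = List ℕ

at : WeakComp → ℕ → ℕ
at []       _             = 0
at (x ∷ xs) zero          = 0
at (x ∷ xs) (suc zero)    = x
at (x ∷ xs) (suc (suc j)) = at xs (suc j)

isZero : ℕ → Bool
isZero n = n ≡ᵇ 0

_⊴_ : WeakComp → WeakComp → Set
β ⊴ γ = ∀ (j : ℕ) → sum (take j β) ≤ sum (take j γ)

build : ℕ → (ℕ → ℕ) → WeakComp
build n f = applyUpTo (λ k → f (suc k)) n

sTildeEntry : ℕ → WeakComp → ℕ → ℕ
sTildeEntry i α k =
  if isZero (at α i) ∨ isZero (at α (suc i))
  then (if k ≡ᵇ i then at α (suc i)
        else if k ≡ᵇ suc i then at α i
        else at α k)
  else at α k

sTilde : ℕ → WeakComp → WeakComp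
sTilde i α = build (length α ⊔ suc i) (sTildeEntry i α)

firstNZ : List ℕ → Maybe ℕ
firstNZ []       = nothing
firstNZ (zero ∷ xs)  = firstNZ xs
firstNZ (suc a ∷ xs) = just (suc a)

predOrZero : Maybe ℕ → ℕ
predOrZero (just a) = a ∸ 1
predOrZero nothing  = 0

-- Entry j (1-indexed) of qshift(v), following rules (1)-(4) of the definition.
-- Rule (1): j ∈ S.  Rule (3): j = 1 ∉ S, value v_{i_1} - 1 (the first nonzero
-- entry).  Rule (2): j = i_m + 1 ∉ S with i_m ∈ S, value v_{i_{m+1}} - 1 where
-- i_{m+1} is the next nonzero position after j (if none, rule (4) gives 0).
qshiftEntry : WeakComp → ℕ → ℕ
qshiftEntry v zero = 0
qshiftEntry v (suc zero) =
  if not (isZero (at v 1)) then at v 1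
  else predOrZero (firstNZ (drop 1 v))
qshiftEntry v (suc (suc k)) =
  if not (isZero (at v (suc (suc k))))
  then (if not (isZero (at v (suc k))) then at v (suc (suc k)) else 1)
  else (if not (isZero (at v (suc k)))
        then predOrZero (firstNZ (drop (suc (suc k)) v))
        else 0)

qshift : WeakComp → WeakComp
qshift v = build (length v) (qshiftEntry v)

mergeEntry : ℕ → WeakComp → ℕ → ℕ
mergeEntry i β k =
  if k ≡ᵇ i then at β i + at β (suc i)
  else if k ≡ᵇ suc i then 0
  else at β k

mergeAt : ℕ → WeakComp → WeakComp
mergeAt i β = build (length β ⊔ suc i) (mergeEntry i β)

-- Because α_i = 0, s̃_i α slides α_{i+1} into the empty slot i: it is the same
-- merge at i that turns β into γ.  Merging at i turns the partial sum up to j into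
-- the partial sum up to σ(j), where σ(i) = i+1 and σ(j) = j otherwise, so merging
-- preserves dominance.  This gives the lower bound and, as β ⊴ qshift α, reduces
-- the upper bound to  merge(qshift α) ⊴ qshift(merge α).  At a position j with
-- v_j = 0, qshift v has moved all but one unit of the next nonzero entry to the
-- left of j, so its partial sum exceeds that of v by this entry minus 1 (and by 0
-- when v_j ≠ 0).  Sliding α_{i+1} into a zero does not change the next nonzero
-- entry after any position other than i+1, so the excess of merge α at j is at
-- least the excess of α at σ(j).
module Submission where

open import Defs
open import Data.Nat using (ℕ; _≤_; _≡ᵇ_)
open import Data.List using (length)
open import Relation.Binary.PropositionalEquality using (_≡_)
open import Data.Product using (_×_)

open import Data.Nat using (zero; suc; _+_; _∸_; _⊔_; z≤n; s≤s)
open import Data.Nat.Properties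
open import Data.Nat.ListAction using (sum)
open import Data.Bool using (true; false; if_then_else_)
open import Data.List using ([]; _∷_; take; drop)
open import Data.List.Properties using (drop-all)
open import Data.Maybe using (just)
open import Data.Product using (_,_)
open import Relation.Binary.Definitions using (tri<; tri≈; tri>)
open import Relation.Binary.PropositionalEquality
  using (_≢_; refl; sym; trans; cong; cong₂; subst₂; module ≡-Reasoning)
open import Relation.Nullary using (yes; no)
open import Relation.Nullary.Decidable using (dec-true; dec-false)
open import Relation.Nullary.Negation using (contradiction)
open import Function using (_∘_)

≡ᵇ-refl : ∀ n → (n ≡ᵇ n) ≡ true
≡ᵇ-refl n = dec-true (n ≟ n) refl

≢⇒≡ᵇ≡false : ∀ {m n} → m ≢ n → (m ≡ᵇ n) ≡ false
≢⇒≡ᵇ≡false {m} {n} = dec-false (m ≟ n)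

psum : (ℕ → ℕ) → ℕ → ℕ
psum f zero    = 0
psum f (suc j) = psum f j + f (suc j)

psum-cong : ∀ {f g} → (∀ k → f (suc k) ≡ g (suc k)) → ∀ j → psum f j ≡ psum g j
psum-cong f≗g zero    = refl
psum-cong f≗g (suc j) = cong₂ _+_ (psum-cong f≗g j) (f≗g j)

psum-at-[] : ∀ j → psum (at []) j ≡ 0
psum-at-[] zero    = refl
psum-at-[] (suc j) = trans (+-identityʳ _) (psum-at-[] j)

psum-at-∷ : ∀ x xs j → psum (at (x ∷ xs)) (suc j) ≡ x + psum (at xs) j
psum-at-∷ x xs zero    = +-comm 0 x
psum-at-∷ x xs (suc j) = trans (cong (_+ at xs (suc j)) (psum-at-∷ x xs j)) (+-assoc x _ _)

sum-take≡psum : ∀ v j → sum (take j v) ≡ psum (at v) j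
sum-take≡psum []       zero    = refl
sum-take≡psum []       (suc j) = sym (psum-at-[] (suc j))
sum-take≡psum (x ∷ xs) zero    = refl
sum-take≡psum (x ∷ xs) (suc j) =
  trans (cong (x +_) (sum-take≡psum xs j)) (sym (psum-at-∷ x xs j))

at-≥length : ∀ v {k} → length v ≤ k → at v (suc k) ≡ 0
at-≥length []       _        = refl
at-≥length (x ∷ xs) (s≤s le) = at-≥length xs le

at-drop : ∀ k v m → at (drop k v) (suc m) ≡ at v (suc (k + m))
at-drop zero    v        m = refl
at-drop (suc k) []       m = refl
at-drop (suc k) (x ∷ xs) m = at-drop k xs m

at-build : ∀ n f → (∀ k → n ≤ k → f (suc k) ≡ 0) →
           ∀ k → at (build n f) (suc k) ≡ f (suc k)
at-build zero    f vanish k       = sym (vanish k z≤n)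
at-build (suc n) f vanish zero    = refl
at-build (suc n) f vanish (suc k) =
  at-build n (λ k → f (suc k)) (λ k le → vanish (suc k) (s≤s le)) k

build-cong : ∀ n {f g} → (∀ k → f k ≡ g k) → build n f ≡ build n g
build-cong zero    f≗g = refl
build-cong (suc n) f≗g = cong₂ _∷_ (f≗g 1) (build-cong n (λ k → f≗g (suc k)))

sum-take-build : ∀ n f → (∀ k → n ≤ k → f (suc k) ≡ 0) →
                 ∀ j → sum (take j (build n f)) ≡ psum f j
sum-take-build n f vanish j =
  trans (sum-take≡psum (build n f) j) (psum-cong (at-build n f vanish) j)

⊴-trans : ∀ {α β γ} → α ⊴ β → β ⊴ γ → α ⊴ γ
⊴-trans α⊴β β⊴γ j = ≤-trans (α⊴β j) (β⊴γ j)

firstNZ-drop : ∀ v k → firstNZ (drop k v) ≡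
  (if isZero (at v (suc k)) then firstNZ (drop (suc k) v) else just (at v (suc k)))
firstNZ-drop []           zero    = refl
firstNZ-drop []           (suc k) = refl
firstNZ-drop (zero ∷ xs)  zero    = refl
firstNZ-drop (suc x ∷ xs) zero    = refl
firstNZ-drop (x ∷ xs)     (suc k) = firstNZ-drop xs k

firstNZ-cong : ∀ u v → (∀ m → at u (suc m) ≡ at v (suc m)) → firstNZ u ≡ firstNZ v
firstNZ-cong []           []       u≗v = refl
firstNZ-cong []           (y ∷ ys) u≗v with refl ← u≗v 0 = firstNZ-cong [] ys (u≗v ∘ suc)
firstNZ-cong (x ∷ xs)     []       u≗v with refl ← u≗v 0 = firstNZ-cong xs [] (u≗v ∘ suc)
firstNZ-cong (zero ∷ xs)  (y ∷ ys) u≗v with refl ← u≗v 0 = firstNZ-cong xs ys (u≗v ∘ suc)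
firstNZ-cong (suc x ∷ xs) (y ∷ ys) u≗v with refl ← u≗v 0 = refl

firstNZ-drop-cong : ∀ k u v → (∀ m → k ≤ m → at u (suc m) ≡ at v (suc m)) →
                    firstNZ (drop k u) ≡ firstNZ (drop k v)
firstNZ-drop-cong k u v agree = firstNZ-cong (drop k u) (drop k v) λ m →
  trans (at-drop k u m) (trans (agree (k + m) (m≤m+n k m)) (sym (at-drop k v m)))

excess : WeakComp → ℕ → ℕ
excess v zero    = 0
excess v (suc k) = if isZero (at v (suc k)) then predOrZero (firstNZ (drop (suc k) v)) else 0

excess-step : ∀ v j → excess v j + qshiftEntry v (suc j) ≡ at v (suc j) + excess v (suc j)
excess-step v zero with at v 1
... | zero  = refl
... | suc _ = sym (+-identityʳ _)
excess-step v (suc k) rewrite firstNZ-drop v (suc k) with at v (suc k) | at v (suc (suc k))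
... | zero  | zero  = +-identityʳ _
... | zero  | suc y = trans (+-comm y 1) (sym (+-identityʳ (suc y)))
... | suc _ | zero  = refl
... | suc _ | suc _ = sym (+-identityʳ _)

psum-qshiftEntry : ∀ v j → psum (qshiftEntry v) j ≡ psum (at v) j + excess v j
psum-qshiftEntry v zero    = refl
psum-qshiftEntry v (suc j) = begin
    psum (qshiftEntry v) j + qshiftEntry v (suc j)
  ≡⟨ cong (_+ qshiftEntry v (suc j)) (psum-qshiftEntry v j) ⟩
    psum (at v) j + excess v j + qshiftEntry v (suc j)
  ≡⟨ +-assoc (psum (at v) j) _ _ ⟩
    psum (at v) j + (excess v j + qshiftEntry v (suc j))
  ≡⟨ cong (psum (at v) j +_) (excess-step v j) ⟩
    psum (at v) j + (at v (suc j) + excess v (suc j))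
  ≡⟨ +-assoc (psum (at v) j) _ _ ⟨
    psum (at v) (suc j) + excess v (suc j)
  ∎
  where open ≡-Reasoning

qshiftEntry-≥length : ∀ v {k} → length v ≤ k → qshiftEntry v (suc k) ≡ 0
qshiftEntry-≥length []       {zero}  _  = refl
qshiftEntry-≥length v        {suc k} le
  rewrite at-≥length v le | drop-all (suc (suc k)) v (m≤n⇒m≤1+n le)
  with isZero (at v (suc k))
... | true  = refl
... | false = refl

sum-take-qshift : ∀ v j → sum (take j (qshift v)) ≡ psum (at v) j + excess v j
sum-take-qshift v j =
  trans (sum-take-build (length v) (qshiftEntry v) (λ k → qshiftEntry-≥length v) j)
        (psum-qshiftEntry v j)

mergedIndex : ℕ → ℕ → ℕ
mergedIndex i j = if j ≡ᵇ i then suc i else j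

mergedIndex-≡ : ∀ i → mergedIndex i i ≡ suc i
mergedIndex-≡ i rewrite ≡ᵇ-refl i = refl

mergedIndex-≢ : ∀ {i j} → j ≢ i → mergedIndex i j ≡ j
mergedIndex-≢ j≢i rewrite ≢⇒≡ᵇ≡false j≢i = refl

mergeEntry-unchanged : ∀ i v {k} → k ≢ i → k ≢ suc i → mergeEntry i v k ≡ at v k
mergeEntry-unchanged i v k≢i k≢1+i
  rewrite ≢⇒≡ᵇ≡false k≢i | ≢⇒≡ᵇ≡false k≢1+i = refl

mergeEntry-beyond : ∀ i v {m} → suc i ≤ m → mergeEntry i v (suc m) ≡ at v (suc m)
mergeEntry-beyond i v i<m = mergeEntry-unchanged i v (>⇒≢ (m<n⇒m<1+n i<m)) (>⇒≢ (s≤s i<m))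

at-mergeAt : ∀ i v k → at (mergeAt i v) (suc k) ≡ mergeEntry i v (suc k)
at-mergeAt i v = at-build (length v ⊔ suc i) (mergeEntry i v) λ k le →
  trans (mergeEntry-beyond i v (≤-trans (m≤n⊔m (length v) (suc i)) le))
        (at-≥length v (≤-trans (m≤m⊔n (length v) (suc i)) le))

at-mergeAt-merged : ∀ i v → at (mergeAt (suc i) v) (suc i) ≡ at v (suc i) + at v (suc (suc i))
at-mergeAt-merged i v rewrite at-mergeAt (suc i) v i | ≡ᵇ-refl i = refl

at-mergeAt-vacated : ∀ i v → at (mergeAt i v) (suc i) ≡ 0
at-mergeAt-vacated i v
  rewrite at-mergeAt i v i | ≢⇒≡ᵇ≡false (1+n≢n {i}) | ≡ᵇ-refl i = refl

at-mergeAt-unchanged : ∀ i v {k} → suc k ≢ i → suc k ≢ suc i →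
                       at (mergeAt i v) (suc k) ≡ at v (suc k)
at-mergeAt-unchanged i v {k} 1+k≢i 1+k≢1+i =
  trans (at-mergeAt i v k) (mergeEntry-unchanged i v 1+k≢i 1+k≢1+i)

at-mergeAt-beyond : ∀ i v {m} → suc i ≤ m → at (mergeAt i v) (suc m) ≡ at v (suc m)
at-mergeAt-beyond i v {m} i<m = trans (at-mergeAt i v m) (mergeEntry-beyond i v i<m)

psum-mergeAt : ∀ {i} v → 1 ≤ i →
               ∀ j → psum (at (mergeAt i v)) j ≡ psum (at v) (mergedIndex i j)
psum-mergeAt v (s≤s z≤n) zero = refl
psum-mergeAt {i} v 1≤i (suc k) with suc k ≟ i | k ≟ i
... | yes refl | _ = begin
    psum (at (mergeAt i v)) k + at (mergeAt i v) i
  ≡⟨ cong₂ _+_ (trans (psum-mergeAt v 1≤i k)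
                      (cong (psum (at v)) (mergedIndex-≢ (<⇒≢ (n<1+n k)))))
               (at-mergeAt-merged k v) ⟩
    psum (at v) k + (at v i + at v (suc i))
  ≡⟨ +-assoc (psum (at v) k) _ _ ⟨
    psum (at v) (suc i)
  ≡⟨ cong (psum (at v)) (mergedIndex-≡ i) ⟨
    psum (at v) (mergedIndex i i)
  ∎
  where open ≡-Reasoning
... | no _ | yes refl = begin
    psum (at (mergeAt i v)) i + at (mergeAt i v) (suc i)
  ≡⟨ cong₂ _+_ (trans (psum-mergeAt v 1≤i i) (cong (psum (at v)) (mergedIndex-≡ i)))
               (at-mergeAt-vacated i v) ⟩
    psum (at v) (suc i) + 0
  ≡⟨ +-identityʳ _ ⟩
    psum (at v) (suc i)
  ≡⟨ cong (psum (at v)) (mergedIndex-≢ 1+n≢n) ⟨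
    psum (at v) (mergedIndex i (suc i))
  ∎
  where open ≡-Reasoning
... | no 1+k≢i | no k≢i = begin
    psum (at (mergeAt i v)) k + at (mergeAt i v) (suc k)
  ≡⟨ cong₂ _+_ (trans (psum-mergeAt v 1≤i k) (cong (psum (at v)) (mergedIndex-≢ k≢i)))
               (at-mergeAt-unchanged i v 1+k≢i (k≢i ∘ suc-injective)) ⟩
    psum (at v) (suc k)
  ≡⟨ cong (psum (at v)) (mergedIndex-≢ 1+k≢i) ⟨
    psum (at v) (mergedIndex i (suc k))
  ∎
  where open ≡-Reasoning

sum-take-mergeAt : ∀ {i} v → 1 ≤ i → ∀ j →
                   sum (take j (mergeAt i v)) ≡ sum (take (mergedIndex i j) v)
sum-take-mergeAt {i} v 1≤i j =
  trans (sum-take≡psum (mergeAt i v) j)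
        (trans (psum-mergeAt v 1≤i j) (sym (sum-take≡psum v (mergedIndex i j))))

mergeAt-mono-⊴ : ∀ {i α β} → 1 ≤ i → α ⊴ β → mergeAt i α ⊴ mergeAt i β
mergeAt-mono-⊴ {i} {α} {β} 1≤i α⊴β j =
  subst₂ _≤_ (sym (sum-take-mergeAt α 1≤i j)) (sym (sum-take-mergeAt β 1≤i j))
         (α⊴β (mergedIndex i j))

firstNZ-drop-mergeAt-beyond : ∀ i v {k} → suc i ≤ k →
                              firstNZ (drop k (mergeAt i v)) ≡ firstNZ (drop k v)
firstNZ-drop-mergeAt-beyond i v {k} i<k =
  firstNZ-drop-cong k (mergeAt i v) v λ m k≤m → at-mergeAt-beyond i v (≤-trans i<k k≤m)

firstNZ-drop-mergeAt-vacated : ∀ i v → firstNZ (drop i (mergeAt i v)) ≡ firstNZ (drop (suc i) v)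
firstNZ-drop-mergeAt-vacated i v
  rewrite firstNZ-drop (mergeAt i v) i | at-mergeAt-vacated i v =
  firstNZ-drop-mergeAt-beyond i v ≤-refl

firstNZ-drop-mergeAt-below : ∀ {i} v → at v i ≡ 0 → ∀ d k → suc (d + k) ≡ i →
                             firstNZ (drop k (mergeAt i v)) ≡ firstNZ (drop k v)
firstNZ-drop-mergeAt-below v vᵢ≡0 zero k refl = begin
    firstNZ (drop k (mergeAt (suc k) v))
  ≡⟨ firstNZ-drop (mergeAt (suc k) v) k ⟩
    (if isZero (at (mergeAt (suc k) v) (suc k)) then firstNZ (drop (suc k) (mergeAt (suc k) v))
     else just (at (mergeAt (suc k) v) (suc k)))
  ≡⟨ cong₂ (λ x rest → if isZero x then rest else just x)
           (trans (at-mergeAt-merged k v) (cong (_+ at v (suc (suc k))) vᵢ≡0))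
           (firstNZ-drop-mergeAt-vacated (suc k) v) ⟩
    (if isZero (at v (suc (suc k))) then firstNZ (drop (suc (suc k)) v)
     else just (at v (suc (suc k))))
  ≡⟨ firstNZ-drop v (suc k) ⟨
    firstNZ (drop (suc k) v)
  ≡⟨ cong (λ x → if isZero x then firstNZ (drop (suc k) v) else just x) vᵢ≡0 ⟨
    (if isZero (at v (suc k)) then firstNZ (drop (suc k) v) else just (at v (suc k)))
  ≡⟨ firstNZ-drop v k ⟨
    firstNZ (drop k v)
  ∎
  where open ≡-Reasoning
firstNZ-drop-mergeAt-below v vᵢ≡0 (suc d) k refl
  rewrite firstNZ-drop (mergeAt (suc (suc (d + k))) v) k | firstNZ-drop v k
        | at-mergeAt-unchanged (suc (suc (d + k))) v
            (<⇒≢ (s≤s (s≤s (m≤n+m k d)))) (<⇒≢ (s≤s (m≤n⇒m≤1+n (s≤s (m≤n+m k d)))))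
        | firstNZ-drop-mergeAt-below v vᵢ≡0 d (suc k) (cong suc (+-suc d k)) = refl

firstNZ-drop-mergeAt-≢ : ∀ {i} v → at v i ≡ 0 → ∀ {k} → k ≢ i →
                         firstNZ (drop k (mergeAt i v)) ≡ firstNZ (drop k v)
firstNZ-drop-mergeAt-≢ {i} v vᵢ≡0 {k} k≢i with <-cmp k i
... | tri< k<i _ _ = firstNZ-drop-mergeAt-below v vᵢ≡0 (i ∸ suc k) k
                       (trans (sym (+-suc _ k)) (m∸n+n≡m k<i))
... | tri≈ _ k≡i _ = contradiction k≡i k≢i
... | tri> _ _ i<k = firstNZ-drop-mergeAt-beyond i v i<k

excess-mergeAt : ∀ {i} v → 1 ≤ i → at v i ≡ 0 →
                 ∀ j → excess v (mergedIndex i j) ≤ excess (mergeAt i v) j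
excess-mergeAt v (s≤s z≤n) vᵢ≡0 zero = z≤n
excess-mergeAt {i} v 1≤i vᵢ≡0 (suc k) with suc k ≟ i | k ≟ i
... | yes refl | _
  rewrite mergedIndex-≡ i | at-mergeAt-merged k v | firstNZ-drop-mergeAt-vacated i v | vᵢ≡0
  = ≤-refl
... | no _ | yes refl
  rewrite mergedIndex-≢ (1+n≢n {i}) | at-mergeAt-vacated i v
        | firstNZ-drop-mergeAt-beyond i v ≤-refl
  with isZero (at v (suc i))
...   | true  = ≤-refl
...   | false = z≤n
excess-mergeAt {i} v 1≤i vᵢ≡0 (suc k) | no 1+k≢i | no k≢i
  rewrite mergedIndex-≢ 1+k≢i | at-mergeAt-unchanged i v 1+k≢i (k≢i ∘ suc-injective)
        | firstNZ-drop-mergeAt-≢ v vᵢ≡0 1+k≢i = ≤-refl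

mergeAt-qshift-⊴ : ∀ {i} α → 1 ≤ i → at α i ≡ 0 →
                   mergeAt i (qshift α) ⊴ qshift (mergeAt i α)
mergeAt-qshift-⊴ {i} α 1≤i αᵢ≡0 j = begin
    sum (take j (mergeAt i (qshift α)))
  ≡⟨ sum-take-mergeAt (qshift α) 1≤i j ⟩
    sum (take σj (qshift α))
  ≡⟨ sum-take-qshift α σj ⟩
    psum (at α) σj + excess α σj
  ≤⟨ +-monoʳ-≤ (psum (at α) σj) (excess-mergeAt α 1≤i αᵢ≡0 j) ⟩
    psum (at α) σj + excess (mergeAt i α) j
  ≡⟨ cong (_+ excess (mergeAt i α) j) (psum-mergeAt α 1≤i j) ⟨
    psum (at (mergeAt i α)) j + excess (mergeAt i α) j
  ≡⟨ sum-take-qshift (mergeAt i α) j ⟨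
    sum (take j (qshift (mergeAt i α)))
  ∎
  where
  open ≤-Reasoning
  σj = mergedIndex i j

sTilde≡mergeAt : ∀ {i} α → at α i ≡ 0 → sTilde i α ≡ mergeAt i α
sTilde≡mergeAt {i} α αᵢ≡0 = build-cong (length α ⊔ suc i) sTildeEntry≗mergeEntry
  where
  sTildeEntry≗mergeEntry : ∀ k → sTildeEntry i α k ≡ mergeEntry i α k
  sTildeEntry≗mergeEntry k rewrite αᵢ≡0 = refl

mainTheorem1 : (α β : WeakComp) (i : ℕ) → 1 ≤ i → i ≤ length α → at α i ≡ 0 →
    α ⊴ β → β ⊴ qshift α →
    (sTilde i α ⊴ mergeAt i β) × (mergeAt i β ⊴ qshift (sTilde i α))
mainTheorem1 α β i 1≤i _ αᵢ≡0 α⊴β β⊴qα rewrite sTilde≡mergeAt α αᵢ≡0 =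
  mergeAt-mono-⊴ 1≤i α⊴β ,
  ⊴-trans (mergeAt-mono-⊴ 1≤i β⊴qα) (mergeAt-qshift-⊴ α 1≤i αᵢ≡0)
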